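{- Let $p$ be an odd prime and let $\rho:G_{\mathbb{Q}}\to\mathrm{GL}_2(\overline{\mathbb{F}}_p)$ be continuous, odd and irreducible. Suppose $\rho_p=\rho|_{G_{\mathbb{Q}_p}}$ is irreducible. Then $\mathrm{BM}(\rho)=W(\rho)$.
   Context: $G_{\mathbb{Q}_p}\subset G_{\mathbb{Q}}$ is a decomposition group at $p$, coming from a fixed embedding $\overline{\mathbb{Q}}\hookrightarrow\overline{\mathbb{Q}}_p$. $I_p$ is its inertia subgroup. $\omega$ is the mod $p$ cyclotomic character and $\omega_2$ a fundamental character of level $2$. Serre weights: $V_{a,b}=\det^a\otimes\mathrm{Sym}^{b-1}\overline{\mathbb{F}}_p^2$ as representations of $\mathrm{GL}_2(\mathbb{F}_p)$, where $0\le a\le p-2$ and $1\le b\le p$. The index $a$ is taken modulo $p-1$, i.e. $V_{a+p-1,b}=V_{a,b}$. The set $W(\rho)$, for $\rho_p$ irreducible, is defined as follows. Write $\rho|_{I_p}\sim\omega^c\otimes\mathrm{diag}(\omega_2^b,\omega_2^{pb})$ with $1\le b\le p-1$. Then $W(\rho)=\{V_{c,b},V_{c+b-1,p+1-b}\}$; that is, $W=\{V_{0,b},V_{b-1,p+1-b}\}$ twisted by $\det^c$. Kisin's multiplicities, in the case $\rho_p$ irreducible: for $n\in\{0,\dots,p-1\}$ and $m\in\{0,\dots,p-2\}$, set $\mu_{n,m}(\rho)=1$ if $\rho|_{I_p}\sim\omega^m\otimes\mathrm{diag}(\omega_2^{n+1},\omega_2^{p(n+1)})$, and $\mu_{n,m}(\rho)=0$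 otherwise. Define $\mathrm{BM}(\rho)=\{V_{m,n+1}:\mu_{n,m}(\rho)>0\}$. -}

module Defs where

open import Data.Nat using (ℕ; suc; _+_; _*_; _∸_; _≤_)
open import Data.Integer as ℤ using (ℤ; +_)
open import Data.Integer.Divisibility using () renaming (_∣_ to _∣ℤ_)
open import Data.Product using (_×_; _,_; ∃-syntax)
open import Data.Sum using (_⊎_)
open import Relation.Binary.PropositionalEquality using (_≡_)

ModEq : ℕ → ℕ → ℕ → Set
ModEq N x y = (+ N) ∣ℤ ((+ x) ℤ.- (+ y))

-- Tame characters of I_p are powers of the level-2 fundamental character ω₂,
-- which has order p² − 1; ω = ω₂^(p+1).  A character is recorded by its
-- exponent of ω₂ (taken mod p² − 1).
ω₂-order : ℕ → ℕ
ω₂-order p = p * p ∸ 1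

-- A semisimple 2-dimensional tame representation of I_p, diag(ω₂^x, ω₂^y),
-- recorded by the pair of exponents (x , y).
TameType : Set
TameType = ℕ × ℕ

-- Isomorphism of such representations: the multisets of characters agree.
TypeEquiv : ℕ → TameType → TameType → Set
TypeEquiv p (x , y) (x' , y') =
  (ModEq (ω₂-order p) x x' × ModEq (ω₂-order p) y y')
  ⊎ (ModEq (ω₂-order p) x y' × ModEq (ω₂-order p) y x')

-- ω^m ⊗ diag(ω₂^u, ω₂^(p u)), using ω = ω₂^(p+1)
twistDiag : ℕ → ℕ → ℕ → TameType
twistDiag p m u = (m * (p + 1) + u , m * (p + 1) + p * u)

-- Serre weight V_{a,b} = det^a ⊗ Sym^(b-1), recorded as the pair (a , b)
SerreWeight : Set
SerreWeight = ℕ × ℕ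

V : ℕ → ℕ → SerreWeight
V a b = (a , b)

IsSerreWeight : ℕ → SerreWeight → Set
IsSerreWeight p (a , b) = a ≤ p ∸ 2 × (1 ≤ b × b ≤ p)

SWEq : ℕ → SerreWeight → SerreWeight → Set
SWEq p (a , b) (a' , b') = ModEq (p ∸ 1) a a' × b ≡ b'

-- Kisin's multiplicity μ_{n,m}(ρ) = 1 (ρ_p irreducible case), in terms of
-- the inertial type τ ≅ ρ|_{I_p}
μ-pos : ℕ → TameType → ℕ → ℕ → Set
μ-pos p τ n m = TypeEquiv p τ (twistDiag p m (suc n))

InBM : ℕ → TameType → SerreWeight → Set
InBM p τ W = ∃[ n ] ∃[ m ] (n ≤ p ∸ 1 × m ≤ p ∸ 2 × μ-pos p τ n m × SWEq p W (V m (suc n)))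

InW : ℕ → ℕ → ℕ → SerreWeight → Set
InW p c b W = SWEq p W (V c b) ⊎ SWEq p W (V (c + b ∸ 1) (p + 1 ∸ b))

{-# OPTIONS --safe #-}

-- Write q = p + 1, so that ω = ω₂^q and ω₂ has order (p − 1) q.  An exponent m q + u with
-- 0 ≤ u ≤ p determines u exactly (reduce modulo q) and m modulo p − 1 (then cancel q).
-- Since c q + p b = (c + b − 1) q + (p + 1 − b), the type ω^c ⊗ diag(ω₂^b, ω₂^(pb)) is also
-- ω^(c+b−1) ⊗ diag(ω₂^(p+1−b), ω₂^(p(p+1−b))).  Hence ω^m ⊗ diag(ω₂^u, ω₂^(pu)) is isomorphic
-- to it exactly when V_{m,u} is V_{c,b} or V_{c+b−1,p+1−b}: the weights with μ > 0 are those of W(ρ).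

module Submission where

open import Defs
open import Data.Nat using (ℕ; _≤_; _∸_)
open import Data.Nat.Primality using (Prime)
open import Data.Product using (_×_)
open import Function.Bundles using (_⇔_)
open import Relation.Binary.PropositionalEquality using (_≢_)

open import Data.Nat.Base using (zero; suc; _+_; _*_; _<_; z≤n; z<s; NonZero; >-nonZero)
import Data.Nat.Properties as ℕₚ
open import Data.Nat.Divisibility using (>⇒∤) renaming (_∣_ to _∣ℕ_)
open import Data.Nat.Tactic.RingSolver using (solve-∀)
open import Data.Integer.Base as ℤ using (ℤ; +_)
import Data.Integer.Properties as ℤₚ
open import Data.Integer.Divisibility.Signed
  using (_∣_; divides; ∣ᵤ⇒∣; ∣⇒∣ᵤ; ∣-refl; ∣-reflexive; ∣-trans; ∣m∣n⇒∣m+n; ∣m+n∣m⇒∣n; ∣n⇒∣m*n; *-monoˡ-∣; *-cancelʳ-∣)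
import Data.Integer.Tactic.RingSolver as ℤ-Solver
open import Data.Product using (_,_; proj₁; proj₂)
open import Data.Sum using (inj₁; inj₂)
open import Data.Empty using (⊥-elim)
open import Function.Bundles using (mk⇔; Equivalence)
open import Relation.Binary.PropositionalEquality
  using (_≡_; refl; sym; trans; cong; cong₂; subst; subst₂; module ≡-Reasoning)

-- ModEq N x y unfolds to divisibility of ∣ x − y ∣, from which x and y cannot be inferred,
-- so the compared numbers are explicit arguments throughout.
ModEq⇒∣ : ∀ {N} x y → ModEq N x y → + N ∣ + x ℤ.- + y
ModEq⇒∣ _ _ = ∣ᵤ⇒∣

∣⇒ModEq : ∀ {N} x y → + N ∣ + x ℤ.- + y → ModEq N x y
∣⇒ModEq _ _ = ∣⇒∣ᵤ

ModEq-reflexive : ∀ {N} x y → x ≡ y → ModEq N x y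
ModEq-reflexive x _ refl = ∣⇒ModEq x x (divides (+ 0) (ℤₚ.+-inverseʳ (+ x)))

ModEq-sym : ∀ {N} x y → ModEq N x y → ModEq N y x
ModEq-sym {N} x y = subst (N ∣ℕ_) (ℤₚ.∣i-j∣≡∣j-i∣ (+ x) (+ y))

ModEq-trans : ∀ {N} x y z → ModEq N x y → ModEq N y z → ModEq N x z
ModEq-trans {N} x y z x≡y y≡z = ∣⇒ModEq x z (subst (+ N ∣_) (ℤₚ.+-minus-telescope (+ x) (+ y) (+ z))
  (∣m∣n⇒∣m+n (ModEq⇒∣ x y x≡y) (ModEq⇒∣ y z y≡z)))

ModEq-+-modulus : ∀ N x → ModEq N (x + N) x
ModEq-+-modulus N x = ∣⇒ModEq (x + N) x (∣-reflexive (sym (begin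
  + (x + N) ℤ.- + x     ≡⟨ cong (ℤ._- + x) (ℤₚ.pos-+ x N) ⟩
  (+ x ℤ.+ + N) ℤ.- + x ≡⟨ [i+j]-i≡j (+ x) (+ N) ⟩
  + N                   ∎)))
  where
  open ≡-Reasoning
  [i+j]-i≡j : ∀ i j → (i ℤ.+ j) ℤ.- i ≡ j
  [i+j]-i≡j = ℤ-Solver.solve-∀

ModEq-unique : ∀ {N} u v → u < N → v < N → ModEq N u v → u ≡ v
ModEq-unique {N} u v u<N v<N u≡v =
  ℤₚ.+-injective (ℤₚ.i-j≡0⇒i≡j (+ u) (+ v) (ℤₚ.∣i∣≡0⇒i≡0 (m<n∧n∣m⇒m≡0 distance<N u≡v)))
  where
  distance<N : ℤ.∣ + u ℤ.- + v ∣ < N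
  distance<N = subst (_< N) (cong ℤ.∣_∣ (sym (ℤₚ.m-n≡m⊖n u v)))
                 (ℕₚ.≤-<-trans (ℤₚ.∣m⊝n∣≤m⊔n u v) (ℕₚ.⊔-pres-<m u<N v<N))
  m<n∧n∣m⇒m≡0 : ∀ {d} → d < N → N ∣ℕ d → d ≡ 0
  m<n∧n∣m⇒m≡0 {zero}  _   _   = refl
  m<n∧n∣m⇒m≡0 {suc d} d<N N∣d = ⊥-elim (>⇒∤ d<N N∣d)

pos-*-+ : ∀ m k u → + (m * k + u) ≡ + m ℤ.* + k ℤ.+ + u
pos-*-+ m k u = trans (ℤₚ.pos-+ (m * k) u) (cong (ℤ._+ + u) (ℤₚ.pos-* m k))

pos-[m*k+u]-[n*k+v] : ∀ m n k u v →
  + (m * k + u) ℤ.- + (n * k + v) ≡ (+ m ℤ.- + n) ℤ.* + k ℤ.+ (+ u ℤ.- + v)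
pos-[m*k+u]-[n*k+v] m n k u v = begin
  + (m * k + u) ℤ.- + (n * k + v)
    ≡⟨ cong₂ ℤ._-_ (pos-*-+ m k u) (pos-*-+ n k v) ⟩
  (+ m ℤ.* + k ℤ.+ + u) ℤ.- (+ n ℤ.* + k ℤ.+ + v)
    ≡⟨ regroup (+ m) (+ n) (+ k) (+ u) (+ v) ⟩
  (+ m ℤ.- + n) ℤ.* + k ℤ.+ (+ u ℤ.- + v) ∎
  where
  open ≡-Reasoning
  regroup : ∀ a b c i j → (a ℤ.* c ℤ.+ i) ℤ.- (b ℤ.* c ℤ.+ j) ≡ (a ℤ.- b) ℤ.* c ℤ.+ (i ℤ.- j)
  regroup = ℤ-Solver.solve-∀

pos-[m*k+u]-[n*k+u] : ∀ m n k u → + (m * k + u) ℤ.- + (n * k + u) ≡ (+ m ℤ.- + n) ℤ.* + k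
pos-[m*k+u]-[n*k+u] m n k u = begin
  + (m * k + u) ℤ.- + (n * k + u)          ≡⟨ pos-[m*k+u]-[n*k+v] m n k u u ⟩
  (+ m ℤ.- + n) ℤ.* + k ℤ.+ (+ u ℤ.- + u) ≡⟨ cong (ℤ._+_ ((+ m ℤ.- + n) ℤ.* + k)) (ℤₚ.+-inverseʳ (+ u)) ⟩
  (+ m ℤ.- + n) ℤ.* + k ℤ.+ + 0           ≡⟨ ℤₚ.+-identityʳ _ ⟩
  (+ m ℤ.- + n) ℤ.* + k                   ∎
  where open ≡-Reasoning

ModEq-remainder : ∀ {d k} m n u v → u < k → v < k →
  ModEq (d * k) (m * k + u) (n * k + v) → u ≡ v
ModEq-remainder {d} {k} m n u v u<k v<k h = ModEq-unique u v u<k v<k (∣⇒ModEq u v k∣u-v)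
  where
  k∣difference : + k ∣ (+ m ℤ.- + n) ℤ.* + k ℤ.+ (+ u ℤ.- + v)
  k∣difference = ∣-trans (∣n⇒∣m*n (+ d) ∣-refl)
    (subst₂ _∣_ (ℤₚ.pos-* d k) (pos-[m*k+u]-[n*k+v] m n k u v) (ModEq⇒∣ (m * k + u) (n * k + v) h))
  k∣u-v : + k ∣ + u ℤ.- + v
  k∣u-v = ∣m+n∣m⇒∣n k∣difference (∣n⇒∣m*n (+ m ℤ.- + n) ∣-refl)

ModEq-quotient : ∀ {d k} .{{_ : NonZero k}} m n u →
  ModEq (d * k) (m * k + u) (n * k + u) → ModEq d m n
ModEq-quotient {d} {k} m n u h = ∣⇒ModEq m n (*-cancelʳ-∣ (+ k)
  (subst₂ _∣_ (ℤₚ.pos-* d k) (pos-[m*k+u]-[n*k+u] m n k u) (ModEq⇒∣ (m * k + u) (n * k + u) h)))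

ModEq-*-+-cong : ∀ {d} k m n u → ModEq d m n → ModEq (d * k) (m * k + u) (n * k + u)
ModEq-*-+-cong {d} k m n u h = ∣⇒ModEq (m * k + u) (n * k + u)
  (subst₂ _∣_ (sym (ℤₚ.pos-* d k)) (sym (pos-[m*k+u]-[n*k+u] m n k u))
    (*-monoˡ-∣ (+ k) (ModEq⇒∣ m n h)))

ModEq-quot-rem : ∀ {d k} m n u v → u < k → v < k →
  ModEq (d * k) (m * k + u) (n * k + v) → ModEq d m n × u ≡ v
ModEq-quot-rem {d} {k} m n u v u<k v<k h = ModEq-quotient {d} {{k≢0}} m n u h′ , u≡v
  where
  k≢0 : NonZero k
  k≢0 = >-nonZero (ℕₚ.≤-<-trans z≤n u<k)
  u≡v : u ≡ v
  u≡v = ModEq-remainder {d} m n u v u<k v<k h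
  h′ : ModEq (d * k) (m * k + u) (n * k + u)
  h′ = subst (λ w → ModEq (d * k) (m * k + u) (n * k + w)) (sym u≡v) h

TypeEquiv-sym : ∀ p σ τ → TypeEquiv p σ τ → TypeEquiv p τ σ
TypeEquiv-sym p (x , y) (x′ , y′) (inj₁ (x≡x′ , y≡y′)) =
  inj₁ (ModEq-sym x x′ x≡x′ , ModEq-sym y y′ y≡y′)
TypeEquiv-sym p (x , y) (x′ , y′) (inj₂ (x≡y′ , y≡x′)) =
  inj₂ (ModEq-sym y x′ y≡x′ , ModEq-sym x y′ x≡y′)

TypeEquiv-trans : ∀ p σ τ υ → TypeEquiv p σ τ → TypeEquiv p τ υ → TypeEquiv p σ υ
TypeEquiv-trans p (x , y) (x′ , y′) (x″ , y″) (inj₁ (a₁ , a₂)) (inj₁ (b₁ , b₂)) =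
  inj₁ (ModEq-trans x x′ x″ a₁ b₁ , ModEq-trans y y′ y″ a₂ b₂)
TypeEquiv-trans p (x , y) (x′ , y′) (x″ , y″) (inj₁ (a₁ , a₂)) (inj₂ (b₁ , b₂)) =
  inj₂ (ModEq-trans x x′ y″ a₁ b₁ , ModEq-trans y y′ x″ a₂ b₂)
TypeEquiv-trans p (x , y) (x′ , y′) (x″ , y″) (inj₂ (a₁ , a₂)) (inj₁ (b₁ , b₂)) =
  inj₂ (ModEq-trans x y′ y″ a₁ b₂ , ModEq-trans y x′ x″ a₂ b₁)
TypeEquiv-trans p (x , y) (x′ , y′) (x″ , y″) (inj₂ (a₁ , a₂)) (inj₂ (b₁ , b₂)) =
  inj₁ (ModEq-trans x y′ x″ a₁ b₂ , ModEq-trans y x′ y″ a₂ b₁)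

ω₂-order≡ : ∀ p → ω₂-order p ≡ (p ∸ 1) * (p + 1)
ω₂-order≡ zero    = refl
ω₂-order≡ (suc r) = identity r
  where
  identity : ∀ r → r + r * suc r ≡ r * (suc r + 1)
  identity = solve-∀

twistDiag-cong : ∀ p u m n → ModEq (p ∸ 1) m n → TypeEquiv p (twistDiag p m u) (twistDiag p n u)
twistDiag-cong p u m n m≡n = inj₁ (lift u , lift (p * u))
  where
  lift : ∀ v → ModEq (ω₂-order p) (m * (p + 1) + v) (n * (p + 1) + v)
  lift v = subst (λ N → ModEq N (m * (p + 1) + v) (n * (p + 1) + v)) (sym (ω₂-order≡ p))
                 (ModEq-*-+-cong (p + 1) m n v m≡n)

twistDiag-reflect-exponents : ∀ p c b → 1 ≤ b → b ≤ p →
  c * (p + 1) + p * b ≡ (c + b ∸ 1) * (p + 1) + (p + 1 ∸ b)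
  × (c + b ∸ 1) * (p + 1) + p * (p + 1 ∸ b) ≡ c * (p + 1) + b + ω₂-order p
twistDiag-reflect-exponents p c (suc b₀) _ b≤p with ℕₚ.m≤n⇒∃[o]m+o≡n b≤p
... | r , refl = reflection₁ , reflection₂
  where
  P : ℕ
  P = suc b₀ + r + 1
  c+b∸1≡ : c + suc b₀ ∸ 1 ≡ c + b₀
  c+b∸1≡ = cong (_∸ 1) (ℕₚ.+-suc c b₀)
  p+1∸b≡ : P ∸ suc b₀ ≡ r + 1
  p+1∸b≡ = trans (cong (_∸ b₀) (ℕₚ.+-assoc b₀ r 1)) (ℕₚ.m+n∸m≡n b₀ (r + 1))
  polynomial₁ : ∀ c b₀ r →
    c * (suc b₀ + r + 1) + (suc b₀ + r) * suc b₀ ≡ (c + b₀) * (suc b₀ + r + 1) + (r + 1)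
  polynomial₁ = solve-∀
  polynomial₂ : ∀ c b₀ r →
    (c + b₀) * (suc b₀ + r + 1) + (suc b₀ + r) * (r + 1)
    ≡ c * (suc b₀ + r + 1) + suc b₀ + (b₀ + r + (b₀ + r) * suc (b₀ + r))
  polynomial₂ = solve-∀
  reflection₁ : c * P + (suc b₀ + r) * suc b₀ ≡ (c + suc b₀ ∸ 1) * P + (P ∸ suc b₀)
  reflection₁ = trans (polynomial₁ c b₀ r) (sym (cong₂ (λ s t → s * P + t) c+b∸1≡ p+1∸b≡))
  reflection₂ : (c + suc b₀ ∸ 1) * P + (suc b₀ + r) * (P ∸ suc b₀)
                ≡ c * P + suc b₀ + ω₂-order (suc b₀ + r)
  reflection₂ = trans (cong₂ (λ s t → s * P + (suc b₀ + r) * t) c+b∸1≡ p+1∸b≡) (polynomial₂ c b₀ r)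

twistDiag-reflect : ∀ p c b → 1 ≤ b → b ≤ p →
  TypeEquiv p (twistDiag p c b) (twistDiag p (c + b ∸ 1) (p + 1 ∸ b))
twistDiag-reflect p c b 1≤b b≤p = inj₂ (first≡second′ , second≡first′)
  where
  c′ b′ : ℕ
  c′ = c + b ∸ 1
  b′ = p + 1 ∸ b
  first≡second′ : ModEq (ω₂-order p) (c * (p + 1) + b) (c′ * (p + 1) + p * b′)
  first≡second′ = ModEq-sym (c′ * (p + 1) + p * b′) (c * (p + 1) + b)
    (subst (λ z → ModEq (ω₂-order p) z (c * (p + 1) + b))
      (sym (proj₂ (twistDiag-reflect-exponents p c b 1≤b b≤p)))
      (ModEq-+-modulus (ω₂-order p) (c * (p + 1) + b)))
  second≡first′ : ModEq (ω₂-order p) (c * (p + 1) + p * b) (c′ * (p + 1) + b′)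
  second≡first′ = ModEq-reflexive _ _ (proj₁ (twistDiag-reflect-exponents p c b 1≤b b≤p))

twistDiag-equiv⇔InW : ∀ p m u c b → u ≤ p → 1 ≤ b → b ≤ p →
  TypeEquiv p (twistDiag p m u) (twistDiag p c b) ⇔ InW p c b (V m u)
twistDiag-equiv⇔InW p m u c b u≤p 1≤b b≤p = mk⇔ to from
  where
  c′ b′ : ℕ
  c′ = c + b ∸ 1
  b′ = p + 1 ∸ b
  p<p+1 : p < p + 1
  p<p+1 = ℕₚ.m<m+n p z<s
  b′<p+1 : b′ < p + 1
  b′<p+1 = ℕₚ.∸-monoʳ-< 1≤b (ℕₚ.≤-trans b≤p (ℕₚ.m≤m+n p 1))
  first-components : ∀ n v → v < p + 1 →
    ModEq (ω₂-order p) (m * (p + 1) + u) (n * (p + 1) + v) → ModEq (p ∸ 1) m n × u ≡ v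
  first-components n v v<p+1 e = ModEq-quot-rem m n u v (ℕₚ.≤-<-trans u≤p p<p+1) v<p+1
    (subst (λ N → ModEq N (m * (p + 1) + u) (n * (p + 1) + v)) (ω₂-order≡ p) e)
  to : TypeEquiv p (twistDiag p m u) (twistDiag p c b) → InW p c b (V m u)
  to (inj₁ (e , _)) = inj₁ (first-components c b (ℕₚ.≤-<-trans b≤p p<p+1) e)
  to (inj₂ (e , _)) = inj₂ (first-components c′ b′ b′<p+1
    (subst (ModEq (ω₂-order p) (m * (p + 1) + u)) (proj₁ (twistDiag-reflect-exponents p c b 1≤b b≤p)) e))
  from : InW p c b (V m u) → TypeEquiv p (twistDiag p m u) (twistDiag p c b)
  from (inj₁ (m≡c , refl)) = twistDiag-cong p u m c m≡c
  from (inj₂ (m≡c′ , refl)) =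
    TypeEquiv-trans p (twistDiag p m b′) (twistDiag p c′ b′) (twistDiag p c b)
      (twistDiag-cong p b′ m c′ m≡c′)
      (TypeEquiv-sym p (twistDiag p c b) (twistDiag p c′ b′) (twistDiag-reflect p c b 1≤b b≤p))

InW-resp-SWEq : ∀ p c b W W′ → SWEq p W W′ → InW p c b W′ → InW p c b W
InW-resp-SWEq p c b (a , β) (a′ , β′) (a≡a′ , refl) (inj₁ (a′≡c , β′≡b)) =
  inj₁ (ModEq-trans a a′ c a≡a′ a′≡c , β′≡b)
InW-resp-SWEq p c b (a , β) (a′ , β′) (a≡a′ , refl) (inj₂ (a′≡c′ , β′≡b′)) =
  inj₂ (ModEq-trans a a′ (c + b ∸ 1) a≡a′ a′≡c′ , β′≡b′)

proposition4p4 : (p : ℕ) → Prime p → p ≢ 2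
    → (τ : TameType) (c b : ℕ) → c ≤ p ∸ 2 → 1 ≤ b → b ≤ p ∸ 1
    → TypeEquiv p τ (twistDiag p c b)
    → (W : SerreWeight) → IsSerreWeight p W
    → InBM p τ W ⇔ InW p c b W
proposition4p4 p _ _ τ c b _ _ _ _ (a , zero) (_ , () , _)
proposition4p4 p _ _ τ c b _ 1≤b b≤p∸1 τ≅ (a , suc n) (a≤p∸2 , _ , 1+n≤p) = mk⇔ BM⇒W W⇒BM
  where
  b≤p : b ≤ p
  b≤p = ℕₚ.≤-trans b≤p∸1 (ℕₚ.m∸n≤m p 1)
  BM⇒W : InBM p τ (a , suc n) → InW p c b (a , suc n)
  BM⇒W (n′ , m , _ , _ , τ≅ₘ , W≈ₘ) =
    InW-resp-SWEq p c b (a , suc n) (V m (suc n′)) W≈ₘ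
      (Equivalence.to (twistDiag-equiv⇔InW p m (suc n′) c b (subst (_≤ p) (proj₂ W≈ₘ) 1+n≤p) 1≤b b≤p)
        (TypeEquiv-trans p (twistDiag p m (suc n′)) τ (twistDiag p c b)
          (TypeEquiv-sym p τ (twistDiag p m (suc n′)) τ≅ₘ) τ≅))
  W⇒BM : InW p c b (a , suc n) → InBM p τ (a , suc n)
  W⇒BM w = n , a , ℕₚ.∸-monoˡ-≤ 1 1+n≤p , a≤p∸2 ,
    TypeEquiv-trans p τ (twistDiag p c b) (twistDiag p a (suc n)) τ≅
      (TypeEquiv-sym p (twistDiag p a (suc n)) (twistDiag p c b)
        (Equivalence.from (twistDiag-equiv⇔InW p a (suc n) c b 1+n≤p 1≤b b≤p) w)) ,
    ModEq-reflexive a a refl , refl
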